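{- Let $p$ and $n$ be positive integers with $n\ge (10p)^p$. Let $G$ be an $n$-vertex graph such that the complete bipartite graph $K_{p,p}$ is not a subgraph of the complement $\overline{G}$. Then every $2$-edge-coloring of $G$ contains a monochromatic cycle of length at least $n/4$.
   Context: $\overline{G}$ denotes the complement of $G$. -}

module Defs where

open import Data.Nat using (ℕ; zero; suc; _≤_; _*_; _^_)
open import Data.Fin using (Fin; zero; suc; inject₁; fromℕ)
open import Data.Bool using (Bool; true; false)
open import Data.Product using (Σ; _×_; ∃-syntax)
open import Relation.Binary.PropositionalEquality using (_≡_; _≢_)
open import Relation.Nullary using (¬_)
open import Function.Definitions using (Injective)

record Graph (n : ℕ) : Set where
  field
    adj   : Fin n → Fin n → Bool
    sym   : ∀ u v → adj u v ≡ adj v u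
    irrefl : ∀ u → adj u u ≡ false
open Graph public

Edge : ∀ {n} → Graph n → Fin n → Fin n → Set
Edge G u v = adj G u v ≡ true

CoEdge : ∀ {n} → Graph n → Fin n → Fin n → Set
CoEdge G u v = (u ≢ v) × (adj G u v ≡ false)

KppInComplement : ∀ {n} → ℕ → Graph n → Set
KppInComplement {n} p G =
  Σ (Fin p → Fin n) λ f → Σ (Fin p → Fin n) λ g →
    Injective _≡_ _≡_ f × Injective _≡_ _≡_ g ×
    (∀ i j → f i ≢ g j) × (∀ i j → CoEdge G (f i) (g j))

-- A 2-edge-colouring of G: a colour (Bool) for each unordered pair,
-- i.e. a symmetric colour function (its values on non-edges are irrelevant).
record TwoColouring {n} (G : Graph n) : Set where
  field
    colour    : Fin n → Fin n → Bool
    colourSym : ∀ u v → colour u v ≡ colour v u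
open TwoColouring public

MonoEdge : ∀ {n} {G : Graph n} → TwoColouring G → Bool → Fin n → Fin n → Set
MonoEdge {G = G} c b u v = Edge G u v × colour c u v ≡ b

MonoCycle : ∀ {n} {G : Graph n} → TwoColouring G → Bool → ℕ → Set
MonoCycle {n} c b zero = Data.Empty.⊥ where import Data.Empty
MonoCycle {n} c b (suc m) =
  3 ≤ suc m ×
  Σ (Fin (suc m) → Fin n) λ v →
    Injective _≡_ _≡_ v ×
    (∀ (i : Fin m) → MonoEdge c b (v (inject₁ i)) (v (suc i))) ×
    MonoEdge c b (v (fromℕ m)) (v zero)

module Submission where

-- The engine is the depth-first search lemma: for a symmetric relation on a vertex list U
-- and t ≤ |U|, the list U splits into S, P, T with P a path, |T| = t and no edge from S to T.
-- With q ≈ 3n/16 the proof has two stages.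
-- Stage 1 searches along the edges of colour true with t = q. If |S| ≥ q, then q vertices
--   of S and the set T form a separated pair: two disjoint q-sets joined only by edges of
--   colour false. Otherwise P is long; an edge of colour true between its first q and its
--   last q vertices closes a long cycle, and if there is none these ends are a separated pair.
-- Stage 2 works in a separated pair (X, Y). For p = 1 the graph is complete, and alternating
--   between X and Y gives a cycle of length 2q. For p ≥ 2 it searches along the X–Y edges
--   with t = 2p − 1; K_{p,p}-freeness of the complement forces the path, which alternates
--   between X and Y, to be long, and an edge from the X-vertices among its first 2p to the
--   Y-vertices among its last 2p vertices closes a cycle of length at least 2q + 5 − 8p.

open import Defs hiding (sym)
open import Data.Nat using (ℕ; zero; suc; _+_; _*_; _^_; _≤_; _<_; z≤n; s≤s)
open import Data.Nat.Properties
open import Data.Nat.DivMod using (_/_; _%_; m≡m%n+[m/n]*n; m%n<n; m/n*n≤m)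
open import Data.Nat.Tactic.RingSolver using (solve-∀)
open import Data.Bool using (Bool; true; false; not)
open import Data.Bool.Properties using (¬-not; not-¬) renaming (_≟_ to _≟ᵇ_)
open import Data.Fin using (Fin; zero; suc; inject₁; fromℕ; inject≤)
open import Data.Fin.Properties using (inject≤-injective) renaming (_≟_ to _≟ᶠ_)
open import Data.List using (List; []; _∷_; _++_; [_]; length; lookup; filter; allFin)
open import Data.List.Properties using (++-assoc; ++-identityʳ; length-++; length-tabulate; filter-++; filter-all; filter-none)
open import Data.List.Membership.Propositional using (_∈_; find; lose)
open import Data.List.Membership.Propositional.Properties using (∈-++⁺ˡ; ∈-++⁺ʳ; ∈-++⁻; ∈-∃++; ∈-lookup; ∈-filter⁻)
open import Data.List.Relation.Unary.Any using (here; there; any?)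
open import Data.List.Relation.Unary.All using (All; []; _∷_)
import Data.List.Relation.Unary.All as All
open import Data.List.Relation.Unary.All.Properties using (++⁻ˡ; ++⁻ʳ; All¬⇒¬Any)
open import Data.List.Relation.Unary.AllPairs using ([]; _∷_)
open import Data.List.Relation.Unary.Unique.Propositional using (Unique)
import Data.List.Relation.Unary.Unique.Propositional.Properties as Unique
open import Data.List.Relation.Unary.Linked using (Linked; []; [-]; _∷_)
import Data.List.Relation.Unary.Linked as Linked
open import Data.List.Relation.Binary.Disjoint.Propositional using (Disjoint)
open import Data.List.Relation.Binary.Permutation.Propositional
  using (_↭_; prep; swap; ↭-reflexive; ↭-sym) renaming (refl to ↭-refl; trans to ↭-trans)
open import Data.List.Relation.Binary.Permutation.Propositional.Properties using (All-resp-↭; ∈-resp-↭; filter-↭; ↭-length; shift; ++⁺ˡ)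
open import Data.Product using (Σ; _×_; _,_; proj₁; proj₂)
open import Data.Sum using (_⊎_; inj₁; inj₂)
open import Data.Empty using (⊥; ⊥-elim)
open import Relation.Nullary using (¬_; Dec; yes; no)
open import Relation.Nullary.Decidable using (_×-dec_; ¬?; does)
import Data.List.Membership.DecPropositional as DecMembership
open import Relation.Binary.PropositionalEquality
  using (_≡_; _≢_; refl; sym; trans; cong; cong₂; subst; module ≡-Reasoning)

module _ {A : Set} where

  Unique-resp-↭ : ∀ {xs ys : List A} → xs ↭ ys → Unique xs → Unique ys
  Unique-resp-↭ ↭-refl u = u
  Unique-resp-↭ (prep x p) (x∉ ∷ u) = All-resp-↭ p x∉ ∷ Unique-resp-↭ p u
  Unique-resp-↭ (swap x y p) ((x≢y ∷ x∉) ∷ (y∉ ∷ u)) =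
    ((λ y≡x → x≢y (sym y≡x)) ∷ All-resp-↭ p y∉) ∷ All-resp-↭ p x∉ ∷ Unique-resp-↭ p u
  Unique-resp-↭ (↭-trans p q) u = Unique-resp-↭ q (Unique-resp-↭ p u)

  Unique-++ˡ : ∀ xs {ys : List A} → Unique (xs ++ ys) → Unique xs
  Unique-++ˡ [] u = []
  Unique-++ˡ (x ∷ xs) (x∉ ∷ u) = ++⁻ˡ xs x∉ ∷ Unique-++ˡ xs u

  Unique-++ʳ : ∀ xs {ys : List A} → Unique (xs ++ ys) → Unique ys
  Unique-++ʳ [] u = u
  Unique-++ʳ (x ∷ xs) (_ ∷ u) = Unique-++ʳ xs u

  Unique-++-disjoint : ∀ xs {ys : List A} → Unique (xs ++ ys) → Disjoint xs ys
  Unique-++-disjoint (x ∷ xs) (x∉ ∷ u) (here refl , v∈ys) = All¬⇒¬Any (++⁻ʳ xs x∉) v∈ys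
  Unique-++-disjoint (x ∷ xs) (_ ∷ u) (there v∈xs , v∈ys) = Unique-++-disjoint xs u (v∈xs , v∈ys)

  Unique-drop-middle : ∀ xs ys {zs : List A} → Unique (xs ++ ys ++ zs) → Unique (xs ++ zs)
  Unique-drop-middle xs ys u =
    Unique.++⁺ (Unique-++ˡ xs u) (Unique-++ʳ ys (Unique-++ʳ xs u))
      (λ (v∈xs , v∈zs) → Unique-++-disjoint xs u (v∈xs , ∈-++⁺ʳ ys v∈zs))

  relatedPair? : ∀ {R : A → A → Set} → (∀ x y → Dec (R x y)) → (X Y : List A) →
    (Σ A λ x → Σ A λ y → x ∈ X × y ∈ Y × R x y) ⊎ (∀ {x y} → x ∈ X → y ∈ Y → ¬ R x y)
  relatedPair? R? X Y with any? (λ x → any? (R? x) Y) X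
  ... | yes found with find found
  ...   | x , x∈X , toY with find toY
  ...     | y , y∈Y , r = inj₁ (x , y , x∈X , y∈Y , r)
  relatedPair? R? X Y | no none = inj₂ (λ x∈X y∈Y r → none (lose x∈X (lose y∈Y r)))

  lookup-injective : ∀ (xs : List A) → Unique xs → ∀ {i j} → lookup xs i ≡ lookup xs j → i ≡ j
  lookup-injective (x ∷ xs) u {zero} {zero} e = refl
  lookup-injective (x ∷ xs) u {zero} {suc j} e =
    ⊥-elim (Unique-++-disjoint [ x ] u (here refl , subst (_∈ xs) (sym e) (∈-lookup j)))
  lookup-injective (x ∷ xs) u {suc i} {zero} e =
    ⊥-elim (Unique-++-disjoint [ x ] u (here refl , subst (_∈ xs) e (∈-lookup i)))
  lookup-injective (x ∷ xs) (_ ∷ u) {suc i} {suc j} e = cong suc (lookup-injective xs u e)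

module _ {A : Set} {R : A → A → Set} where

  Linked-++ˡ : ∀ xs {ys : List A} → Linked R (xs ++ ys) → Linked R xs
  Linked-++ˡ [] _ = []
  Linked-++ˡ (x ∷ []) _ = [-]
  Linked-++ˡ (x ∷ y ∷ xs) (r ∷ l) = r ∷ Linked-++ˡ (y ∷ xs) l

  Linked-++ʳ : ∀ xs {ys : List A} → Linked R (xs ++ ys) → Linked R ys
  Linked-++ʳ [] l = l
  Linked-++ʳ (x ∷ xs) l = Linked-++ʳ xs (Linked.tail l)

  lookup-Linked : ∀ x xs → Linked R (x ∷ xs) →
    ∀ (i : Fin (length xs)) → R (lookup (x ∷ xs) (inject₁ i)) (lookup (x ∷ xs) (suc i))
  lookup-Linked x (y ∷ ys) (r ∷ l) zero = r
  lookup-Linked x (y ∷ ys) (r ∷ l) (suc i) = lookup-Linked y ys l i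

module _ {A : Set} where

  record Split₃ (xs : List A) (a b : ℕ) : Set where
    field
      front middle back : List A
      decomposition : xs ≡ front ++ middle ++ back
      front-length : length front ≡ a
      back-length : length back ≡ b

    total-length : a + (length middle + b) ≡ length xs
    total-length = begin
      a + (length middle + b)
        ≡⟨ cong₂ (λ u v → u + (length middle + v)) (sym front-length) (sym back-length) ⟩
      length front + (length middle + length back)
        ≡⟨ cong (length front +_) (sym (length-++ middle)) ⟩
      length front + length (middle ++ back)
        ≡⟨ sym (length-++ front) ⟩
      length (front ++ middle ++ back)
        ≡⟨ cong length (sym decomposition) ⟩
      length xs ∎
      where open ≡-Reasoning

  split₃ : ∀ a b (xs : List A) → a + b ≤ length xs → Split₃ xs a b
  split₃ (suc a) b (x ∷ xs) (s≤s a+b≤) with split₃ a b xs a+b≤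
  ... | record { front = F ; middle = M ; back = B ; decomposition = refl
               ; front-length = refl ; back-length = lB } =
    record { front = x ∷ F ; middle = M ; back = B ; decomposition = refl
           ; front-length = refl ; back-length = lB }
  split₃ zero b [] b≤0 =
    record { front = [] ; middle = [] ; back = [] ; decomposition = refl
           ; front-length = refl ; back-length = sym (n≤0⇒n≡0 b≤0) }
  split₃ zero b (x ∷ xs) b≤ with b ≤? length xs
  ... | yes b≤xs with split₃ zero b xs b≤xs
  ...   | record { front = [] ; middle = M ; back = B ; decomposition = refl
                 ; back-length = lB } =
    record { front = [] ; middle = x ∷ M ; back = B ; decomposition = refl
           ; front-length = refl ; back-length = lB }
  split₃ zero b (x ∷ xs) b≤ | no b≰xs =
    record { front = [] ; middle = [] ; back = x ∷ xs ; decomposition = refl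
           ; front-length = refl ; back-length = ≤-antisym (≰⇒> b≰xs) b≤ }

module Sides {A : Set} (σ : A → Bool) where

  onSide : Bool → List A → List A
  onSide β = filter (λ x → σ x ≟ᵇ β)

  count : Bool → List A → ℕ
  count β xs = length (onSide β xs)

  count-++ : ∀ β xs ys → count β (xs ++ ys) ≡ count β xs + count β ys
  count-++ β xs ys =
    trans (cong length (filter-++ (λ x → σ x ≟ᵇ β) xs ys)) (length-++ (onSide β xs))

  count-↭ : ∀ β {xs ys} → xs ↭ ys → count β xs ≡ count β ys
  count-↭ β p = ↭-length (filter-↭ (λ x → σ x ≟ᵇ β) p)

  count-all : ∀ β {xs} → All (λ x → σ x ≡ β) xs → count β xs ≡ length xs
  count-all β all = cong length (filter-all (λ x → σ x ≟ᵇ β) all)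

  count-none : ∀ β {xs} → All (λ x → σ x ≢ β) xs → count β xs ≡ 0
  count-none β none = cong length (filter-none (λ x → σ x ≟ᵇ β) none)

  count-complement : ∀ β xs → count β xs + count (not β) xs ≡ length xs
  count-complement β [] = refl
  count-complement β (x ∷ xs) with σ x ≟ᵇ β | σ x ≟ᵇ not β
  ... | yes _ | no _ = cong suc (count-complement β xs)
  ... | no _ | yes _ = trans (+-suc _ _) (cong suc (count-complement β xs))
  ... | yes σx≡β | yes σx≡¬β = ⊥-elim (not-¬ {β} refl (trans (sym σx≡β) σx≡¬β))
  ... | no σx≢β | no σx≢¬β = ⊥-elim (σx≢¬β (¬-not σx≢β))

  opposite : ∀ {β x y} → σ x ≡ β → σ y ≡ not β → σ x ≢ σ y
  opposite {β} σx σy σx≡σy = not-¬ {β} refl (trans (sym σx) (trans σx≡σy σy))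

  off-side : ∀ {β x} → σ x ≡ not β → σ x ≢ β
  off-side {β} σx σx≡β = not-¬ {β} refl (trans (sym σx≡β) σx)

  Alternating : List A → Set
  Alternating = Linked (λ x y → σ x ≢ σ y)

  pair-meets-side : ∀ β {x y} xs → σ x ≢ σ y → suc (count β xs) ≤ count β (x ∷ y ∷ xs)
  pair-meets-side β {x} {y} xs σx≢σy with σ x ≟ᵇ β
  ... | yes _ with σ y ≟ᵇ β
  ...   | yes _ = s≤s (n≤1+n _)
  ...   | no _ = ≤-refl
  pair-meets-side β {x} {y} xs σx≢σy | no σx≢β with σ y ≟ᵇ β
  ...   | yes _ = ≤-refl
  ...   | no σy≢β = ⊥-elim (σx≢σy (trans (¬-not σx≢β) (sym (¬-not σy≢β))))

  alternating-count : ∀ β xs → Alternating xs → length xs ≤ 2 * count β xs + 1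
  alternating-count β [] _ = z≤n
  alternating-count β (x ∷ []) _ = m≤n+m 1 _
  alternating-count β (x ∷ y ∷ xs) (σx≢σy ∷ alt) = begin
    suc (suc (length xs))        ≤⟨ s≤s (s≤s (alternating-count β xs (Linked.tail alt))) ⟩
    suc (suc (2 * count β xs + 1)) ≡⟨ regroup (count β xs) ⟩
    2 * suc (count β xs) + 1     ≤⟨ +-monoˡ-≤ 1 (*-monoʳ-≤ 2 (pair-meets-side β xs σx≢σy)) ⟩
    2 * count β (x ∷ y ∷ xs) + 1 ∎
    where
    open ≤-Reasoning
    regroup : ∀ c → suc (suc (2 * c + 1)) ≡ 2 * suc c + 1
    regroup = solve-∀

  alternating-half : ∀ β m xs → Alternating xs → length xs ≡ 2 * m → m ≤ count β xs
  alternating-half β m xs alt len = m<1+n⇒m≤n (*-cancelˡ-< 2 m (suc (count β xs)) (begin-strict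
    2 * m                ≡⟨ sym len ⟩
    length xs            ≤⟨ alternating-count β xs alt ⟩
    2 * count β xs + 1   <⟨ ≤-reflexive (double-suc (count β xs)) ⟩
    2 * suc (count β xs) ∎))
    where
    open ≤-Reasoning
    double-suc : ∀ c → suc (2 * c + 1) ≡ 2 * suc c
    double-suc = solve-∀

  alternating-length : ∀ β xs → Alternating xs → 2 * count β xs ≤ length xs + 1
  alternating-length β xs alt = begin
    2 * c         ≡⟨ cong (c +_) (+-identityʳ c) ⟩
    c + c         ≤⟨ +-monoʳ-≤ c c≤d+1 ⟩
    c + (d + 1)   ≡⟨ sym (+-assoc c d 1) ⟩
    c + d + 1     ≡⟨ cong (_+ 1) (count-complement β xs) ⟩
    length xs + 1 ∎
    where
    open ≤-Reasoning
    c d : ℕ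
    c = count β xs
    d = count (not β) xs
    regroup : ∀ d → 2 * d + 1 ≡ d + 1 + d
    regroup = solve-∀
    c≤d+1 : c ≤ d + 1
    c≤d+1 = +-cancelʳ-≤ d c (d + 1) (begin
      c + d      ≡⟨ count-complement β xs ⟩
      length xs  ≤⟨ alternating-count (not β) xs alt ⟩
      2 * d + 1  ≡⟨ regroup d ⟩
      d + 1 + d  ∎)

module _ {A : Set} where

  lastOf : A → List A → A
  lastOf x [] = x
  lastOf x (y ∷ ys) = lastOf y ys

  lastOf-snoc : ∀ x ys z → lastOf x (ys ++ [ z ]) ≡ z
  lastOf-snoc x [] z = refl
  lastOf-snoc x (y ∷ ys) z = lastOf-snoc y ys z

module _ {A : Set} {R : A → A → Set} where

  record ClosedChain (a : A) : Set where
    field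
      rest : List A
      unique : Unique (a ∷ rest)
      chain : Linked R (a ∷ rest)
      closing : R (lastOf a rest) a

  closeChain : ∀ (F M B : List A) {a b} → Unique (F ++ M ++ B) → Linked R (F ++ M ++ B) →
    a ∈ F → b ∈ B → R b a → Σ (ClosedChain a) λ C → suc (length M) ≤ length (ClosedChain.rest C)
  closeChain F M B {a} {b} u l a∈F b∈B b→a with ∈-∃++ a∈F | ∈-∃++ b∈B
  ... | F₁ , F₂ , refl | B₁ , B₂ , refl =
    record { rest = rest
           ; unique = Unique-++ˡ (a ∷ rest) (Unique-++ʳ F₁ (subst Unique regroup u))
           ; chain = Linked-++ˡ (a ∷ rest) (Linked-++ʳ F₁ (subst (Linked R) regroup l))
           ; closing = subst (λ z → R z a) (sym ends-in-b) b→a } ,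
    long
    where
    rest : List A
    rest = F₂ ++ (M ++ (B₁ ++ [ b ]))
    regroup : (F₁ ++ [ a ] ++ F₂) ++ M ++ (B₁ ++ [ b ] ++ B₂) ≡ F₁ ++ ((a ∷ rest) ++ B₂)
    regroup = begin
      (F₁ ++ a ∷ F₂) ++ M ++ (B₁ ++ b ∷ B₂)
        ≡⟨ ++-assoc F₁ (a ∷ F₂) _ ⟩
      F₁ ++ (a ∷ F₂ ++ (M ++ (B₁ ++ b ∷ B₂)))
        ≡⟨ cong (λ z → F₁ ++ (a ∷ F₂ ++ (M ++ z))) (sym (++-assoc B₁ [ b ] B₂)) ⟩
      F₁ ++ (a ∷ F₂ ++ (M ++ ((B₁ ++ [ b ]) ++ B₂)))
        ≡⟨ cong (λ z → F₁ ++ (a ∷ F₂ ++ z)) (sym (++-assoc M (B₁ ++ [ b ]) B₂)) ⟩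
      F₁ ++ (a ∷ F₂ ++ ((M ++ (B₁ ++ [ b ])) ++ B₂))
        ≡⟨ cong (λ z → F₁ ++ (a ∷ z)) (sym (++-assoc F₂ (M ++ (B₁ ++ [ b ])) B₂)) ⟩
      F₁ ++ ((a ∷ rest) ++ B₂) ∎
      where open ≡-Reasoning
    ends-in-b : lastOf a rest ≡ b
    ends-in-b = begin
      lastOf a (F₂ ++ (M ++ (B₁ ++ [ b ])))
        ≡⟨ cong (λ z → lastOf a (F₂ ++ z)) (sym (++-assoc M B₁ [ b ])) ⟩
      lastOf a (F₂ ++ ((M ++ B₁) ++ [ b ]))
        ≡⟨ cong (lastOf a) (sym (++-assoc F₂ (M ++ B₁) [ b ])) ⟩
      lastOf a ((F₂ ++ (M ++ B₁)) ++ [ b ])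
        ≡⟨ lastOf-snoc a (F₂ ++ (M ++ B₁)) b ⟩
      b ∎
      where open ≡-Reasoning
    long : suc (length M) ≤ length rest
    long = begin
      suc (length M)                                 ≡⟨ +-comm 1 (length M) ⟩
      length M + 1                                   ≤⟨ +-monoʳ-≤ (length M) (m≤n+m 1 (length B₁)) ⟩
      length M + (length B₁ + 1)                     ≤⟨ m≤n+m _ (length F₂) ⟩
      length F₂ + (length M + (length B₁ + 1))       ≡⟨ cong (λ z → length F₂ + (length M + z)) (sym (length-++ B₁)) ⟩
      length F₂ + (length M + length (B₁ ++ [ b ])) ≡⟨ cong (length F₂ +_) (sym (length-++ M)) ⟩
      length F₂ + length (M ++ (B₁ ++ [ b ]))       ≡⟨ sym (length-++ F₂) ⟩
      length rest                                    ∎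
      where open ≤-Reasoning

module _ {A : Set} where

  interleave : List A → List A → List A
  interleave (x ∷ xs) (y ∷ ys) = x ∷ y ∷ interleave xs ys
  interleave _ _ = []

  interleave-length : ∀ xs ys → length xs ≡ length ys → length (interleave xs ys) ≡ 2 * length xs
  interleave-length [] [] _ = refl
  interleave-length (x ∷ xs) (y ∷ ys) e =
    trans (cong (λ m → suc (suc m)) (interleave-length xs ys (suc-injective e))) (double-suc (length xs))
    where
    double-suc : ∀ m → suc (suc (2 * m)) ≡ 2 * suc m
    double-suc = solve-∀

  interleave-↭ : ∀ xs ys → length xs ≡ length ys → interleave xs ys ↭ xs ++ ys
  interleave-↭ [] [] _ = ↭-refl
  interleave-↭ (x ∷ xs) (y ∷ ys) e =
    prep x (↭-trans (prep y (interleave-↭ xs ys (suc-injective e))) (↭-sym (shift y xs ys)))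

  interleave-last : ∀ z xs ys → length xs ≡ length ys → lastOf z (interleave xs ys) ∈ z ∷ ys
  interleave-last z [] [] _ = here refl
  interleave-last z (x ∷ xs) (y ∷ ys) e = there (interleave-last y xs ys (suc-injective e))

  interleave-Linked : ∀ {R : A → A → Set} z xs ys → (∀ {x} → x ∈ xs → R z x) →
    (∀ {x y} → x ∈ xs → y ∈ ys → R x y × R y x) → Linked R (z ∷ interleave xs ys)
  interleave-Linked z [] ys _ _ = [-]
  interleave-Linked z (x ∷ xs) [] _ _ = [-]
  interleave-Linked z (x ∷ xs) (y ∷ ys) z→xs xs↔ys =
    z→xs (here refl) ∷ proj₁ (xs↔ys (here refl) (here refl)) ∷
    interleave-Linked y xs ys (λ x∈ → proj₂ (xs↔ys (there x∈) (here refl)))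
                              (λ x∈ y∈ → xs↔ys (there x∈) (there y∈))

module _ {n : ℕ} {G : Graph n} where

  edge? : ∀ u v → Dec (Edge G u v)
  edge? u v = adj G u v ≟ᵇ true

  Edge-sym : ∀ {u v} → Edge G u v → Edge G v u
  Edge-sym {u} {v} e = trans (Graph.sym G v u) e

  kppFree-edge : ∀ {p} → ¬ KppInComplement p G → (X Y : List (Fin n)) →
    p ≤ length X → p ≤ length Y → Unique X → Unique Y → Disjoint X Y →
    Σ (Fin n) λ x → Σ (Fin n) λ y → x ∈ X × y ∈ Y × Edge G x y
  kppFree-edge {p} noKpp X Y p≤X p≤Y uX uY disjoint with relatedPair? edge? X Y
  ... | inj₁ found = found
  ... | inj₂ none =
    ⊥-elim (noKpp (f , g , f-injective , g-injective , apart , nonAdjacent))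
    where
    f g : Fin p → Fin n
    f i = lookup X (inject≤ i p≤X)
    g j = lookup Y (inject≤ j p≤Y)
    f-injective : ∀ {i j} → f i ≡ f j → i ≡ j
    f-injective {i} {j} e = inject≤-injective p≤X p≤X i j (lookup-injective X uX e)
    g-injective : ∀ {i j} → g i ≡ g j → i ≡ j
    g-injective {i} {j} e = inject≤-injective p≤Y p≤Y i j (lookup-injective Y uY e)
    apart : ∀ i j → f i ≢ g j
    apart i j e = disjoint (∈-lookup _ , subst (_∈ Y) (sym e) (∈-lookup _))
    nonAdjacent : ∀ i j → CoEdge G (f i) (g j)
    nonAdjacent i j = apart i j , ¬-not (none (∈-lookup _) (∈-lookup _))

  module _ (c : TwoColouring G) where

    monoEdge? : ∀ b u v → Dec (MonoEdge c b u v)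
    monoEdge? b u v = edge? u v ×-dec (colour c u v ≟ᵇ b)

    MonoEdge-sym : ∀ {b u v} → MonoEdge c b u v → MonoEdge c b v u
    MonoEdge-sym {u = u} {v} (e , col) = Edge-sym e , trans (colourSym c v u) col

    closedChain⇒cycle : ∀ {b a} (C : ClosedChain {R = MonoEdge c b} a) →
      let open ClosedChain C in 2 ≤ length rest → MonoCycle c b (suc (length rest))
    closedChain⇒cycle {a = a} C 2≤ =
      s≤s 2≤ , lookup (a ∷ rest) , lookup-injective (a ∷ rest) unique ,
      lookup-Linked a rest chain , subst (λ z → MonoEdge c _ z a) (sym (lookup-last a rest)) closing
      where
      open ClosedChain C
      lookup-last : ∀ x xs → lookup (x ∷ xs) (fromℕ (length xs)) ≡ lastOf x xs
      lookup-last x [] = refl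
      lookup-last x (y ∷ ys) = lookup-last y ys

    closeMonoPath : ∀ {b} (F M B : List (Fin n)) {x y} →
      Unique (F ++ M ++ B) → Linked (MonoEdge c b) (F ++ M ++ B) →
      x ∈ F → y ∈ B → MonoEdge c b y x → 1 ≤ length M →
      Σ ℕ λ k → MonoCycle c b k × length M + 2 ≤ k
    closeMonoPath F M B u path x∈F y∈B y→x 1≤M with closeChain F M B u path x∈F y∈B y→x
    ... | C , M<rest =
      suc (length (ClosedChain.rest C)) ,
      closedChain⇒cycle C (≤-trans (s≤s 1≤M) M<rest) ,
      subst (_≤ suc (length (ClosedChain.rest C))) (+-comm 2 (length M)) (s≤s M<rest)

    completeBipartiteCycle : ∀ {b} X Y → length X ≡ length Y → 2 ≤ length X → Unique (X ++ Y) →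
      (∀ {x y} → x ∈ X → y ∈ Y → MonoEdge c b x y) → MonoCycle c b (2 * length X)
    completeBipartiteCycle {b} (x ∷ xs) (y ∷ ys) |X|≡|Y| (s≤s 1≤xs) u X→Y =
      subst (MonoCycle c b) cycle-length (closedChain⇒cycle C (s≤s (≤-trans 1≤xs xs≤interleave)))
      where
      both : ∀ {x′ y′} → x′ ∈ x ∷ xs → y′ ∈ y ∷ ys → MonoEdge c b x′ y′ × MonoEdge c b y′ x′
      both x′∈ y′∈ = X→Y x′∈ y′∈ , MonoEdge-sym (X→Y x′∈ y′∈)
      |xs|≡|ys| : length xs ≡ length ys
      |xs|≡|ys| = suc-injective |X|≡|Y|
      C : ClosedChain x
      C = record
        { rest = y ∷ interleave xs ys
        ; unique = Unique-resp-↭ (↭-sym (interleave-↭ (x ∷ xs) (y ∷ ys) |X|≡|Y|)) u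
        ; chain = X→Y (here refl) (here refl) ∷
                  interleave-Linked y xs ys (λ x′∈ → proj₂ (both (there x′∈) (here refl)))
                                            (λ x′∈ y′∈ → both (there x′∈) (there y′∈))
        ; closing = proj₂ (both (here refl) (interleave-last y xs ys |xs|≡|ys|)) }
      xs≤interleave : length xs ≤ length (interleave xs ys)
      xs≤interleave = subst (length xs ≤_) (sym (interleave-length xs ys |xs|≡|ys|)) (m≤m+n (length xs) _)
      cycle-length : suc (suc (length (interleave xs ys))) ≡ 2 * length (x ∷ xs)
      cycle-length = trans (cong (λ m → suc (suc m)) (interleave-length xs ys |xs|≡|ys|)) (double-suc (length xs))
        where
        double-suc : ∀ m → suc (suc (2 * m)) ≡ 2 * suc m
        double-suc = solve-∀

-- Depth-first search for a symmetric decidable relation R on a list U of vertices.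
module DepthFirstSearch {A : Set} {R : A → A → Set}
    (R? : ∀ x y → Dec (R x y)) (R-sym : ∀ {x y} → R x y → R y x) (U : List A) where

  record State : Set where
    field
      unvisited path finished : List A
      partition : unvisited ++ path ++ finished ↭ U
      isPath : Linked R path
      separated : ∀ {s t} → s ∈ unvisited → t ∈ finished → ¬ R s t

  open State

  -- Unvisited vertices count twice: every search step decreases this measure.
  measure : State → ℕ
  measure st = 2 * length (unvisited st) + length (path st)

  Successor : State → Set
  Successor st = Σ State λ st′ →
    measure st′ < measure st × length (finished st′) ≤ suc (length (finished st))

  extendPath : ∀ S₁ s S₂ v P T → (S₁ ++ s ∷ S₂) ++ (v ∷ P) ++ T ↭ U → Linked R (v ∷ P) →
    (∀ {x t} → x ∈ S₁ ++ s ∷ S₂ → t ∈ T → ¬ R x t) → R v s →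
    Σ State λ st′ → measure st′ < 2 * length (S₁ ++ s ∷ S₂) + length (v ∷ P) × finished st′ ≡ T
  extendPath S₁ s S₂ v P T partition isPath separated v→s =
    record { unvisited = S₁ ++ S₂ ; path = s ∷ v ∷ P ; finished = T
           ; partition = ↭-trans reorder partition ; isPath = R-sym v→s ∷ isPath
           ; separated = λ x∈S → separated (stillUnvisited x∈S) } ,
    ≤-reflexive decrease , refl
    where
    reorder : (S₁ ++ S₂) ++ (s ∷ v ∷ P) ++ T ↭ (S₁ ++ s ∷ S₂) ++ (v ∷ P) ++ T
    reorder = ↭-trans (↭-reflexive (++-assoc S₁ S₂ _))
                (↭-trans (++⁺ˡ S₁ (shift s S₂ ((v ∷ P) ++ T)))
                  (↭-reflexive (sym (++-assoc S₁ (s ∷ S₂) _))))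
    stillUnvisited : ∀ {x} → x ∈ S₁ ++ S₂ → x ∈ S₁ ++ s ∷ S₂
    stillUnvisited x∈ with ∈-++⁻ S₁ x∈
    ... | inj₁ x∈S₁ = ∈-++⁺ˡ x∈S₁
    ... | inj₂ x∈S₂ = ∈-++⁺ʳ S₁ (there x∈S₂)
    regroup : ∀ a b c → suc (2 * (a + b) + suc (suc c)) ≡ 2 * (a + suc b) + suc c
    regroup = solve-∀
    decrease : suc (2 * length (S₁ ++ S₂) + suc (suc (length P)))
               ≡ 2 * length (S₁ ++ s ∷ S₂) + suc (length P)
    decrease rewrite length-++ S₁ {S₂} | length-++ S₁ {s ∷ S₂} =
      regroup (length S₁) (length S₂) (length P)

  step : (st : State) → length (finished st) < length U → Successor st
  step record { unvisited = [] ; path = [] ; partition = partition } T<U =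
    ⊥-elim (<-irrefl (↭-length partition) T<U)
  step record { unvisited = s ∷ S ; path = [] ; finished = T
              ; partition = partition ; separated = separated } _ =
    record { unvisited = S ; path = [ s ] ; finished = T
           ; partition = ↭-trans (shift s S T) partition ; isPath = [-]
           ; separated = λ s∈S → separated (there s∈S) } ,
    ≤-reflexive (regroup (length S)) , n≤1+n _
    where
    regroup : ∀ a → suc (2 * a + 1) ≡ 2 * suc a + 0
    regroup = solve-∀
  step record { unvisited = S ; path = v ∷ P ; finished = T
              ; partition = partition ; isPath = isPath ; separated = separated } _
    with any? (R? v) S
  ... | yes found with find found
  ...   | s , s∈S , v→s with ∈-∃++ s∈S
  ...     | S₁ , S₂ , refl with extendPath S₁ s S₂ v P T partition isPath separated v→s
  ...       | st′ , smaller , refl = st′ , smaller , n≤1+n _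
  step record { unvisited = S ; path = v ∷ P ; finished = T
              ; partition = partition ; isPath = isPath ; separated = separated } _ | no none =
    record { unvisited = S ; path = P ; finished = v ∷ T
           ; partition = ↭-trans (++⁺ˡ S (shift v P T)) partition
           ; isPath = Linked.tail isPath ; separated = separatedNow } ,
    ≤-reflexive (sym (+-suc _ _)) , ≤-refl
    where
    separatedNow : ∀ {s t} → s ∈ S → t ∈ v ∷ T → ¬ R s t
    separatedNow s∈S (here refl) s→v = none (lose s∈S (R-sym s→v))
    separatedNow s∈S (there t∈T) = separated s∈S t∈T

  -- Iterating steps until exactly t vertices are finished; fuel bounds the measure.
  run : ∀ (fuel t : ℕ) (st : State) → measure st < fuel →
    length (finished st) ≤ t → t ≤ length U → Σ State λ st' → length (finished st') ≡ t
  run fuel t st _ T≤t t≤U with length (finished st) ≟ t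
  ... | yes done = st , done
  run zero t st () T≤t t≤U | no _
  run (suc fuel) t st m<fuel T≤t t≤U | no notYet
    with step st (<-≤-trans (≤∧≢⇒< T≤t notYet) t≤U)
  ... | st′ , smaller , grown =
    run fuel t st′ (≤-trans smaller (≤-pred m<fuel)) (≤-trans grown (≤∧≢⇒< T≤t notYet)) t≤U

  dfs : (t : ℕ) → t ≤ length U → Σ State λ st → length (finished st) ≡ t
  dfs t t≤U = run (suc (measure initial)) t initial ≤-refl z≤n t≤U
    where
    initial : State
    initial = record { unvisited = U ; path = [] ; finished = []
                     ; partition = ↭-reflexive (++-identityʳ U) ; isPath = []
                     ; separated = λ _ () }

middle-nonempty : ∀ {a M L} → a + (M + a) ≡ L → a + a < L → 1 ≤ M
middle-nonempty {a} {M} {L} sizes long = +-cancelʳ-≤ (a + a) 1 M (begin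
  1 + (a + a)  ≤⟨ long ⟩
  L            ≡⟨ sym sizes ⟩
  a + (M + a)  ≡⟨ regroup a M ⟩
  M + (a + a)  ∎)
  where
  open ≤-Reasoning
  regroup : ∀ a M → a + (M + a) ≡ M + (a + a)
  regroup = solve-∀

path-long : ∀ {s P q n} → s < q → s + (P + q) ≡ n → 4 * q ≤ n → q + q < P
path-long {s} {P} {q} {n} s<q sizes 4q≤n = +-cancelˡ-≤ (q + q) _ _ (begin
  (q + q) + suc (q + q) ≡⟨ regroup₁ q ⟩
  suc (4 * q)           ≤⟨ s≤s 4q≤n ⟩
  suc n                 ≡⟨ cong suc (sym sizes) ⟩
  suc s + (P + q)       ≤⟨ +-monoˡ-≤ (P + q) s<q ⟩
  q + (P + q)           ≡⟨ regroup₂ q P ⟩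
  (q + q) + P           ∎)
  where
  open ≤-Reasoning
  regroup₁ : ∀ q → (q + q) + suc (q + q) ≡ suc (4 * q)
  regroup₁ = solve-∀
  regroup₂ : ∀ q P → q + (P + q) ≡ (q + q) + P
  regroup₂ = solve-∀

cycle-long : ∀ {s M q n k} → s < q → s + ((q + (M + q)) + q) ≡ n →
  16 * q ≤ 3 * n + 12 → M + 2 ≤ k → n ≤ 4 * k
cycle-long {s} {M} {q} {n} {k} s<q sizes q-upper M+2≤k = +-cancelʳ-≤ (3 * n + 12) n (4 * k) (begin
  n + (3 * n + 12)                  ≡⟨ regroup₁ n ⟩
  4 * n + 12                        ≡⟨ cong (λ m → 4 * m + 12) (sym sizes) ⟩
  4 * (s + ((q + (M + q)) + q)) + 12 ≡⟨ regroup₂ s q M ⟩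
  4 * suc s + (4 * M + 12 * q + 8)  ≤⟨ +-monoˡ-≤ _ (*-monoʳ-≤ 4 s<q) ⟩
  4 * q + (4 * M + 12 * q + 8)      ≡⟨ regroup₃ q M ⟩
  16 * q + 4 * (M + 2)              ≤⟨ +-mono-≤ q-upper (*-monoʳ-≤ 4 M+2≤k) ⟩
  3 * n + 12 + 4 * k                ≡⟨ +-comm (3 * n + 12) (4 * k) ⟩
  4 * k + (3 * n + 12)              ∎)
  where
  open ≤-Reasoning
  regroup₁ : ∀ n → n + (3 * n + 12) ≡ 4 * n + 12
  regroup₁ = solve-∀
  regroup₂ : ∀ s q M → 4 * (s + ((q + (M + q)) + q)) + 12 ≡ 4 * suc s + (4 * M + 12 * q + 8)
  regroup₂ = solve-∀
  regroup₃ : ∀ q M → 4 * q + (4 * M + 12 * q + 8) ≡ 16 * q + 4 * (M + 2)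
  regroup₃ = solve-∀

-- Stage 1
module _ {n : ℕ} {G : Graph n} (c : TwoColouring G) where

  record SeparatedPair (b : Bool) (q : ℕ) : Set where
    field
      left right : List (Fin n)
      left-length : length left ≡ q
      right-length : length right ≡ q
      unique : Unique (left ++ right)
      crossColour : ∀ {x y} → x ∈ left → y ∈ right → Edge G x y → colour c x y ≡ b

  separatedPair : ∀ {b q} X Y → length X ≡ q → length Y ≡ q → Unique (X ++ Y) →
    (∀ {x y} → x ∈ X → y ∈ Y → ¬ MonoEdge c b x y) → SeparatedPair (not b) q
  separatedPair X Y |X| |Y| u none = record
    { left = X ; right = Y ; left-length = |X| ; right-length = |Y| ; unique = u
    ; crossColour = λ x∈X y∈Y e → ¬-not (λ col → none x∈X y∈Y (e , col)) }

  module MonoSearch (b : Bool) = DepthFirstSearch (monoEdge? c b) (MonoEdge-sym c) (allFin n)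

  module FirstSearch (b : Bool) (st : MonoSearch.State b) where
    open MonoSearch.State b st renaming (unvisited to S; path to P; finished to T)

    allUnique : Unique (S ++ P ++ T)
    allUnique = Unique-resp-↭ (↭-sym partition) (Unique.allFin⁺ n)

    sizes : length S + (length P + length T) ≡ n
    sizes = begin
      length S + (length P + length T) ≡⟨ cong (length S +_) (sym (length-++ P)) ⟩
      length S + length (P ++ T)       ≡⟨ sym (length-++ S) ⟩
      length (S ++ P ++ T)             ≡⟨ ↭-length partition ⟩
      length (allFin n)                ≡⟨ length-tabulate (λ i → i) ⟩
      n                                ∎
      where open ≡-Reasoning

    pairFromUnvisited : ∀ q → length T ≡ q → q ≤ length S → SeparatedPair (not b) q
    pairFromUnvisited q |T| q≤S =
      separatedPair X T front-length |T| uXT (λ x∈X t∈T → separated (X⊆S x∈X) t∈T)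
      where
      open Split₃ (split₃ q 0 S (subst (_≤ length S) (sym (+-identityʳ q)) q≤S))
        renaming (front to X)
      X⊆S : ∀ {x} → x ∈ X → x ∈ S
      X⊆S x∈X = subst (_ ∈_) (sym decomposition) (∈-++⁺ˡ x∈X)
      uXT : Unique (X ++ T)
      uXT = Unique-drop-middle X (middle ++ back)
              (subst Unique (++-assoc X (middle ++ back) T)
                (subst (λ S → Unique (S ++ T)) decomposition (Unique-drop-middle S P allUnique)))

    cycleOrPairFromPath : ∀ q → length T ≡ q → length S < q →
      16 * q ≤ 3 * n + 12 → 4 * q ≤ n →
      (Σ ℕ λ k → n ≤ 4 * k × MonoCycle c b k) ⊎ SeparatedPair (not b) q
    cycleOrPairFromPath q |T| S<q q-upper 4q≤n = decide (relatedPair? (monoEdge? c b) F B)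
      where
      sizes′ : length S + (length P + q) ≡ n
      sizes′ = subst (λ t → length S + (length P + t) ≡ n) |T| sizes
      P-long : q + q < length P
      P-long = path-long S<q sizes′ 4q≤n
      open Split₃ (split₃ q q P (<⇒≤ P-long)) renaming (front to F; middle to M; back to B)
      uP : Unique (F ++ M ++ B)
      uP = subst Unique decomposition (Unique-++ˡ P (Unique-++ʳ S allUnique))
      pathP : Linked (MonoEdge c b) (F ++ M ++ B)
      pathP = subst (Linked _) decomposition isPath
      1≤M : 1 ≤ length M
      1≤M = middle-nonempty {q} {length M} total-length P-long
      decide : (Σ (Fin n) λ x → Σ (Fin n) λ y → x ∈ F × y ∈ B × MonoEdge c b x y)
             ⊎ (∀ {x y} → x ∈ F → y ∈ B → ¬ MonoEdge c b x y) →
             (Σ ℕ λ k → n ≤ 4 * k × MonoCycle c b k) ⊎ SeparatedPair (not b) q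
      decide (inj₁ (x , y , x∈F , y∈B , x→y)) =
        let k , cycle , M+2≤k = closeMonoPath c F M B uP pathP x∈F y∈B (MonoEdge-sym c x→y) 1≤M
        in inj₁ (k , cycle-long S<q (trans (cong (λ p → length S + (p + q)) total-length) sizes′)
                                q-upper M+2≤k , cycle)
      decide (inj₂ none) =
        inj₂ (separatedPair F B front-length back-length (Unique-drop-middle F M uP) none)

  longCycleOrSeparatedPair : ∀ b q → 16 * q ≤ 3 * n + 12 → 4 * q ≤ n →
    (Σ ℕ λ k → n ≤ 4 * k × MonoCycle c b k) ⊎ SeparatedPair (not b) q
  longCycleOrSeparatedPair b q q-upper 4q≤n = afterSearch (MonoSearch.dfs b q q≤n)
    where
    q≤n : q ≤ length (allFin n)
    q≤n = subst (q ≤_) (sym (length-tabulate (λ i → i))) (≤-trans (m≤n*m q 4) 4q≤n)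
    afterSearch : (Σ (MonoSearch.State b) λ st → length (MonoSearch.State.finished st) ≡ q) →
      (Σ ℕ λ k → n ≤ 4 * k × MonoCycle c b k) ⊎ SeparatedPair (not b) q
    afterSearch (st , |T|) with q ≤? length (MonoSearch.State.unvisited st)
    ... | yes q≤S = inj₂ (FirstSearch.pairFromUnvisited b st q |T| q≤S)
    ... | no q≰S = FirstSearch.cycleOrPairFromPath b st q |T| (≰⇒> q≰S) q-upper 4q≤n

search-fits : ∀ p′ q → 4 * suc p′ ≤ q + 1 → suc p′ + p′ ≤ q + q
search-fits p′ q q-large = ≤-trans (+-cancelʳ-≤ 1 _ q (begin
  suc p′ + p′ + 1                 ≤⟨ m≤m+n _ (2 * p′ + 2) ⟩
  suc p′ + p′ + 1 + (2 * p′ + 2) ≡⟨ regroup p′ ⟩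
  4 * suc p′                      ≤⟨ q-large ⟩
  q + 1                           ∎)) (m≤m+n q q)
  where
  open ≤-Reasoning
  regroup : ∀ p′ → suc p′ + p′ + 1 + (2 * p′ + 2) ≡ 4 * suc p′
  regroup = solve-∀

other-side-large : ∀ {a d} p′ → a + d ≡ suc p′ + p′ → a ≤ p′ → suc p′ ≤ d
other-side-large {a} {d} p′ sum a≤p′ = +-cancelˡ-≤ a (suc p′) d (begin
  a + suc p′  ≤⟨ +-monoˡ-≤ (suc p′) a≤p′ ⟩
  p′ + suc p′ ≡⟨ +-comm p′ (suc p′) ⟩
  suc p′ + p′ ≡⟨ sym sum ⟩
  a + d       ∎)
  where open ≤-Reasoning

-- Here q = a + m + c counts one side of U over S, P, T;
-- T holds d ≥ p vertices of the other side and c of this side, with d + c = 2p − 1;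
-- S holds a < p of this side; and the alternating path P of length L holds m.
path-lower-bound : ∀ {a m c d L} p′ q → a + (m + c) ≡ q → d + c ≡ suc p′ + p′ →
  suc p′ ≤ d → a ≤ p′ → 2 * m ≤ L + 1 → 2 * q + 3 ≤ L + 4 * suc p′
path-lower-bound {a} {m} {c} {d} {L} p′ q counts sizeT p≤d a≤p′ 2m≤L+1 = begin
  2 * q + 3                    ≡⟨ cong (λ z → 2 * z + 3) (sym counts) ⟩
  2 * (a + (m + c)) + 3        ≤⟨ +-monoˡ-≤ 3 (*-monoʳ-≤ 2 (+-mono-≤ a≤p′ (+-monoʳ-≤ m c≤p′))) ⟩
  2 * (p′ + (m + p′)) + 3      ≡⟨ regroup₁ p′ m ⟩
  2 * m + (4 * p′ + 3)         ≤⟨ +-monoˡ-≤ (4 * p′ + 3) 2m≤L+1 ⟩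
  L + 1 + (4 * p′ + 3)         ≡⟨ regroup₂ L p′ ⟩
  L + 4 * suc p′               ∎
  where
  open ≤-Reasoning
  c≤p′ : c ≤ p′
  c≤p′ = +-cancelˡ-≤ (suc p′) c p′ (≤-trans (+-monoˡ-≤ c p≤d) (≤-reflexive sizeT))
  regroup₁ : ∀ p′ m → 2 * (p′ + (m + p′)) + 3 ≡ 2 * m + (4 * p′ + 3)
  regroup₁ = solve-∀
  regroup₂ : ∀ L p′ → L + 1 + (4 * p′ + 3) ≡ L + 4 * suc p′
  regroup₂ = solve-∀

cut-fits : ∀ {L} p q → 2 * q + 3 ≤ L + 4 * p → 4 * p ≤ q + 1 → 2 * p + 2 * p < L
cut-fits {L} p q bound q-large = +-cancelʳ-≤ (4 * p) _ L (begin
  suc (2 * p + 2 * p) + 4 * p ≡⟨ regroup₁ p ⟩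
  2 * (4 * p) + 1             ≤⟨ +-monoˡ-≤ 1 (*-monoʳ-≤ 2 q-large) ⟩
  2 * (q + 1) + 1             ≡⟨ regroup₂ q ⟩
  2 * q + 3                   ≤⟨ bound ⟩
  L + 4 * p                   ∎)
  where
  open ≤-Reasoning
  regroup₁ : ∀ p → suc (2 * p + 2 * p) + 4 * p ≡ 2 * (4 * p) + 1
  regroup₁ = solve-∀
  regroup₂ : ∀ q → 2 * (q + 1) + 1 ≡ 2 * q + 3
  regroup₂ = solve-∀

bipartite-cycle-long : ∀ {M L k} p q → 2 * p + (M + 2 * p) ≡ L → 2 * q + 3 ≤ L + 4 * p →
  M + 2 ≤ k → 2 * q + 5 ≤ k + 8 * p
bipartite-cycle-long {M} {L} {k} p q sizes bound M+2≤k = begin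
  2 * q + 5                           ≡⟨ sym (+-assoc (2 * q) 3 2) ⟩
  2 * q + 3 + 2                       ≤⟨ +-monoˡ-≤ 2 bound ⟩
  L + 4 * p + 2                       ≡⟨ cong (λ z → z + 4 * p + 2) (sym sizes) ⟩
  2 * p + (M + 2 * p) + 4 * p + 2     ≡⟨ regroup p M ⟩
  M + 2 + 8 * p                       ≤⟨ +-monoˡ-≤ (8 * p) M+2≤k ⟩
  k + 8 * p                           ∎
  where
  open ≤-Reasoning
  regroup : ∀ p M → 2 * p + (M + 2 * p) + 4 * p + 2 ≡ M + 2 + 8 * p
  regroup = solve-∀

-- Stage 2
module _ {n : ℕ} {G : Graph n} (c : TwoColouring G) where

  module Bipartite {b q} (pair : SeparatedPair c b q) where
    open SeparatedPair pair renaming (left to X; right to Y)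
    open DecMembership (_≟ᶠ_ {n}) using (_∈?_)

    side : Fin n → Bool
    side v = does (v ∈? X)

    open Sides side

    sideOf : ∀ {v} → v ∈ X ++ Y → (side v ≡ true × v ∈ X) ⊎ (side v ≡ false × v ∈ Y)
    sideOf {v} v∈U with v ∈? X
    ... | yes v∈X = inj₁ (refl , v∈X)
    ... | no v∉X with ∈-++⁻ X v∈U
    ...   | inj₁ v∈X = ⊥-elim (v∉X v∈X)
    ...   | inj₂ v∈Y = inj₂ (refl , v∈Y)

    X-side : ∀ {v} → v ∈ X → side v ≡ true
    X-side v∈X with sideOf (∈-++⁺ˡ v∈X)
    ... | inj₁ (σv , _) = σv
    ... | inj₂ (_ , v∈Y) = ⊥-elim (Unique-++-disjoint X unique (v∈X , v∈Y))

    Y-side : ∀ {v} → v ∈ Y → side v ≡ false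
    Y-side v∈Y with sideOf (∈-++⁺ʳ X v∈Y)
    ... | inj₁ (_ , v∈X) = ⊥-elim (Unique-++-disjoint X unique (v∈X , v∈Y))
    ... | inj₂ (σv , _) = σv

    count-sides : ∀ β → count β (X ++ Y) ≡ q
    count-sides true = begin
      count true (X ++ Y)          ≡⟨ count-++ true X Y ⟩
      count true X + count true Y  ≡⟨ cong₂ _+_ (count-all true (All.tabulate X-side))
                                       (count-none true (All.tabulate λ v∈Y → off-side (Y-side v∈Y))) ⟩
      length X + 0                 ≡⟨ trans (+-identityʳ _) left-length ⟩
      q                            ∎
      where open ≡-Reasoning
    count-sides false = begin
      count false (X ++ Y)           ≡⟨ count-++ false X Y ⟩
      count false X + count false Y  ≡⟨ cong₂ _+_ (count-none false (All.tabulate λ v∈X → off-side (X-side v∈X)))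
                                         (count-all false (All.tabulate Y-side)) ⟩
      0 + length Y                   ≡⟨ right-length ⟩
      q                              ∎
      where open ≡-Reasoning

    Cross : Fin n → Fin n → Set
    Cross u v = MonoEdge c b u v × side u ≢ side v

    cross? : ∀ u v → Dec (Cross u v)
    cross? u v = monoEdge? c b u v ×-dec ¬? (side u ≟ᵇ side v)

    Cross-sym : ∀ {u v} → Cross u v → Cross v u
    Cross-sym (e , apart) = MonoEdge-sym c e , λ eq → apart (sym eq)

    edge⇒Cross : ∀ {u v} → u ∈ X ++ Y → v ∈ X ++ Y → side u ≢ side v → Edge G u v → Cross u v
    edge⇒Cross {u} {v} u∈ v∈ apart e with sideOf u∈ | sideOf v∈
    ... | inj₁ (σu , _) | inj₁ (σv , _) = ⊥-elim (apart (trans σu (sym σv)))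
    ... | inj₁ (_ , u∈X) | inj₂ (_ , v∈Y) = (e , crossColour u∈X v∈Y e) , apart
    ... | inj₂ (_ , u∈Y) | inj₁ (_ , v∈X) =
      (e , trans (colourSym c u v) (crossColour v∈X u∈Y (Edge-sym {G = G} e))) , apart
    ... | inj₂ (σu , _) | inj₂ (σv , _) = ⊥-elim (apart (trans σu (sym σv)))

    open DepthFirstSearch cross? Cross-sym (X ++ Y)

    module _ (p′ : ℕ) (noKpp : ¬ KppInComplement (suc p′) G)
             (st : State) (|T| : length (State.finished st) ≡ suc p′ + p′) where
      open State st renaming (unvisited to S; path to P; finished to T)

      p : ℕ
      p = suc p′

      allUnique : Unique (S ++ P ++ T)
      allUnique = Unique-resp-↭ (↭-sym partition) unique

      inU : ∀ {v} → v ∈ S ++ P ++ T → v ∈ X ++ Y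
      inU = ∈-resp-↭ partition

      crowdedSide : Σ Bool λ β → p ≤ count β T
      crowdedSide with p ≤? count true T
      ... | yes p≤T = true , p≤T
      ... | no p≰T = false , other-side-large p′ (trans (count-complement true T) |T|) (≤-pred (≰⇒> p≰T))

      -- Fewer than p unvisited vertices lie on the other side: otherwise K_{p,p}-freeness
      -- of the complement yields an edge between them and the crowded finished vertices.
      fewOpposite : ∀ β → p ≤ count β T → count (not β) S ≤ p′
      fewOpposite β p≤T with p ≤? count (not β) S
      ... | no p≰S = ≤-pred (≰⇒> p≰S)
      ... | yes p≤S = ⊥-elim (noEdge (kppFree-edge {G = G} noKpp (onSide β T) (onSide (not β) S) p≤T p≤S
              (Unique.filter⁺ _ (Unique-++ʳ P (Unique-++ʳ S allUnique)))
              (Unique.filter⁺ _ (Unique-++ˡ S allUnique))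
              (λ (v∈T′ , v∈S′) → Unique-++-disjoint S (Unique-drop-middle S P allUnique)
                                   (proj₁ (∈-filter⁻ _ v∈S′) , proj₁ (∈-filter⁻ _ v∈T′)))))
        where
        noEdge : (Σ (Fin n) λ t → Σ (Fin n) λ s → t ∈ onSide β T × s ∈ onSide (not β) S × Edge G t s) → ⊥
        noEdge (t , s , t∈ , s∈ , e) with ∈-filter⁻ _ t∈ | ∈-filter⁻ _ s∈
        ... | t∈T , σt | s∈S , σs =
          separated s∈S t∈T (edge⇒Cross (inU (∈-++⁺ˡ s∈S)) (inU (∈-++⁺ʳ S (∈-++⁺ʳ P t∈T)))
                               (λ eq → opposite σt σs (sym eq)) (Edge-sym {G = G} e))

      -- Hence the path holds almost all vertices of the other side, and alternates.
      pathLong : 2 * q + 3 ≤ length P + 4 * p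
      pathLong = path-lower-bound p′ q (counts (not β)) (trans (count-complement β T) |T|)
                   p≤T (fewOpposite β p≤T) (alternating-length (not β) P (Linked.map proj₂ isPath))
        where
        β : Bool
        β = proj₁ crowdedSide
        p≤T : p ≤ count β T
        p≤T = proj₂ crowdedSide
        counts : ∀ β′ → count β′ S + (count β′ P + count β′ T) ≡ q
        counts β′ = begin
          count β′ S + (count β′ P + count β′ T) ≡⟨ cong (count β′ S +_) (sym (count-++ β′ P T)) ⟩
          count β′ S + count β′ (P ++ T)         ≡⟨ sym (count-++ β′ S (P ++ T)) ⟩
          count β′ (S ++ P ++ T)                 ≡⟨ count-↭ β′ partition ⟩
          count β′ (X ++ Y)                      ≡⟨ count-sides β′ ⟩
          q                                      ∎
          where open ≡-Reasoning

      -- Cut 2p vertices from each end of the path. Being alternating, the front holds p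
      -- vertices of X and the back p of Y; an edge between these closes a long b-cycle.
      longCycle : 4 * p ≤ q + 1 → Σ ℕ λ k → MonoCycle c b k × 2 * q + 5 ≤ k + 8 * p
      longCycle q-large = close (kppFree-edge {G = G} noKpp (onSide true F) (onSide false B) p≤F p≤B
                                  (Unique.filter⁺ _ (Unique-++ˡ F uP))
                                  (Unique.filter⁺ _ (Unique-++ʳ M (Unique-++ʳ F uP)))
                                  disjointFB)
        where
        cut : 2 * p + 2 * p < length P
        cut = cut-fits p q pathLong q-large
        open Split₃ (split₃ (2 * p) (2 * p) P (<⇒≤ cut)) renaming (front to F; middle to M; back to B)
        uP : Unique (F ++ M ++ B)
        uP = subst Unique decomposition (Unique-++ˡ P (Unique-++ʳ S allUnique))
        pathFMB : Linked Cross (F ++ M ++ B)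
        pathFMB = subst (Linked Cross) decomposition isPath
        alternatingFMB : Alternating (F ++ M ++ B)
        alternatingFMB = Linked.map proj₂ pathFMB
        p≤F : p ≤ count true F
        p≤F = alternating-half true p F (Linked-++ˡ F alternatingFMB) front-length
        p≤B : p ≤ count false B
        p≤B = alternating-half false p B (Linked-++ʳ M (Linked-++ʳ F alternatingFMB)) back-length
        disjointFB : Disjoint (onSide true F) (onSide false B)
        disjointFB (v∈F′ , v∈B′) = Unique-++-disjoint F (Unique-drop-middle F M uP)
                                     (proj₁ (∈-filter⁻ _ v∈F′) , proj₁ (∈-filter⁻ _ v∈B′))
        inFMB : ∀ {v} → v ∈ F ++ M ++ B → v ∈ X ++ Y
        inFMB v∈ = inU (∈-++⁺ʳ S (∈-++⁺ˡ (subst (_ ∈_) (sym decomposition) v∈)))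
        close : (Σ (Fin n) λ x → Σ (Fin n) λ y → x ∈ onSide true F × y ∈ onSide false B × Edge G x y) →
                Σ ℕ λ k → MonoCycle c b k × 2 * q + 5 ≤ k + 8 * p
        close (x , y , x∈ , y∈ , e) with ∈-filter⁻ _ x∈ | ∈-filter⁻ _ y∈
        ... | x∈F , σx | y∈B , σy =
          let y→x = edge⇒Cross (inFMB (∈-++⁺ʳ F (∈-++⁺ʳ M y∈B))) (inFMB (∈-++⁺ˡ x∈F))
                                (opposite {false} σy σx) (Edge-sym {G = G} e)
              k , cycle , M+2≤k = closeMonoPath c F M B uP (Linked.map proj₁ pathFMB) x∈F y∈B
                                    (proj₁ y→x) (middle-nonempty {2 * p} {length M} total-length cut)
          in k , cycle , bipartite-cycle-long p q total-length pathLong M+2≤k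

    bipartiteCycle : ∀ p′ → ¬ KppInComplement (suc p′) G → 4 * suc p′ ≤ q + 1 →
      Σ ℕ λ k → MonoCycle c b k × 2 * q + 5 ≤ k + 8 * suc p′
    bipartiteCycle p′ noKpp q-large =
      let st , |T| = dfs (suc p′ + p′) fits in longCycle p′ noKpp st |T| q-large
      where
      fits : suc p′ + p′ ≤ length (X ++ Y)
      fits = subst (suc p′ + p′ ≤_) (sym (trans (length-++ X) (cong₂ _+_ left-length right-length)))
               (search-fits p′ q q-large)

  -- If the complement of G has no edges, the two sets of a separated pair are completely
  -- joined in colour b, which gives a b-cycle of length 2q.
  completePairCycle : ∀ {b q} → ¬ KppInComplement 1 G → SeparatedPair c b q → 2 ≤ q → MonoCycle c b (2 * q)
  completePairCycle {b} {q} noKpp pair 2≤q =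
    subst (λ m → MonoCycle c b (2 * m)) left-length
      (completeBipartiteCycle c X Y (trans left-length (sym right-length))
        (subst (2 ≤_) (sym left-length) 2≤q) unique X→Y)
    where
    open SeparatedPair pair renaming (left to X; right to Y)
    X→Y : ∀ {x y} → x ∈ X → y ∈ Y → MonoEdge c b x y
    X→Y {x} {y} x∈X y∈Y with kppFree-edge {G = G} noKpp [ x ] [ y ] ≤-refl ≤-refl ([] ∷ []) ([] ∷ [])
           (λ { (here refl , here x≡y) → Unique-++-disjoint X unique (x∈X , subst (_∈ Y) (sym x≡y) y∈Y) })
    ... | _ , _ , here refl , here refl , e = e , crossColour x∈X y∈Y e

ten-bound : ∀ p′ n → (10 * suc p′) ^ suc p′ ≤ n → 10 ≤ n
ten-bound p′ n bound = begin
  10                     ≤⟨ m≤m*n 10 (suc p′) ⟩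
  10 * suc p′            ≡⟨ sym (^-identityʳ (10 * suc p′)) ⟩
  (10 * suc p′) ^ 1      ≤⟨ ^-monoʳ-≤ (10 * suc p′) {1} {suc p′} (s≤s z≤n) ⟩
  (10 * suc p′) ^ suc p′ ≤⟨ bound ⟩
  n                      ∎
  where open ≤-Reasoning

linear-bound : ∀ p″ n → (10 * suc (suc p″)) ^ suc (suc p″) ≤ n → 64 * suc (suc p″) ≤ n
linear-bound p″ n bound = begin
  64 * p             ≤⟨ *-monoˡ-≤ p (m≤m+n 64 36) ⟩
  100 * p            ≡⟨ regroup p ⟩
  10 * p * (10 * 1)  ≤⟨ *-monoʳ-≤ (10 * p) (*-monoˡ-≤ 1 (m≤m*n 10 p)) ⟩
  (10 * p) ^ 2       ≤⟨ ^-monoʳ-≤ (10 * p) {2} {p} (s≤s (s≤s z≤n)) ⟩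
  (10 * p) ^ p       ≤⟨ bound ⟩
  n                  ∎
  where
  open ≤-Reasoning
  p : ℕ
  p = suc (suc p″)
  regroup : ∀ p → 100 * p ≡ 10 * p * (10 * 1)
  regroup = solve-∀

choose-q : ∀ n → Σ ℕ λ q → 16 * q ≤ 3 * n + 12 × 3 * n ≤ 16 * q + 3
choose-q n = q , ≤-trans (≤-reflexive (*-comm 16 q)) (m/n*n≤m m 16) , +-cancelʳ-≤ 12 _ _ (begin
  m                ≡⟨ m≡m%n+[m/n]*n m 16 ⟩
  m % 16 + q * 16  ≤⟨ +-monoˡ-≤ (q * 16) (≤-pred (m%n<n m 16)) ⟩
  15 + q * 16      ≡⟨ regroup q ⟩
  16 * q + 3 + 12  ∎)
  where
  open ≤-Reasoning
  m q : ℕ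
  m = 3 * n + 12
  q = m / 16
  regroup : ∀ q → 15 + q * 16 ≡ 16 * q + 3 + 12
  regroup = solve-∀

-- With this q: the first stage applies (4q ≤ n) ...
q-small : ∀ {n q} → 10 ≤ n → 16 * q ≤ 3 * n + 12 → 4 * q ≤ n
q-small {n} {q} 10≤n q-upper = m<1+n⇒m≤n (*-cancelˡ-< 4 (4 * q) (suc n) (begin-strict
  4 * (4 * q)     ≡⟨ regroup₁ q ⟩
  16 * q          ≤⟨ q-upper ⟩
  3 * n + 12      <⟨ ≤-trans (≤-reflexive (sym (+-suc (3 * n) 12)))
                         (+-monoʳ-≤ (3 * n) (+-monoˡ-≤ 4 (≤-trans (n≤1+n 9) 10≤n))) ⟩
  3 * n + (n + 4) ≡⟨ regroup₂ n ⟩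
  4 * suc n       ∎))
  where
  open ≤-Reasoning
  regroup₁ : ∀ q → 4 * (4 * q) ≡ 16 * q
  regroup₁ = solve-∀
  regroup₂ : ∀ n → 3 * n + (n + 4) ≡ 4 * suc n
  regroup₂ = solve-∀

-- ... for p = 1 the complete bipartite cycle of length 2q is long enough ...
q-large₁ : ∀ {n q} → 10 ≤ n → 3 * n ≤ 16 * q + 3 → 2 ≤ q × n ≤ 4 * (2 * q)
q-large₁ {n} {q} 10≤n q-lower =
  *-cancelˡ-< 8 1 q (≤-trans (n≤1+n 9) (≤-trans 10≤n n≤8q)) ,
  subst (n ≤_) (regroup₃ q) n≤8q
  where
  open ≤-Reasoning
  regroup₁ : ∀ n → 2 * n + n ≡ 3 * n
  regroup₁ = solve-∀
  regroup₂ : ∀ q → 16 * q ≡ 2 * (8 * q)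
  regroup₂ = solve-∀
  regroup₃ : ∀ q → 8 * q ≡ 4 * (2 * q)
  regroup₃ = solve-∀
  n≤8q : n ≤ 8 * q
  n≤8q = *-cancelˡ-≤ 2 (+-cancelʳ-≤ 3 _ _ (begin
    2 * n + 3        ≤⟨ +-monoʳ-≤ (2 * n) (≤-trans (m≤m+n 3 7) 10≤n) ⟩
    2 * n + n        ≡⟨ regroup₁ n ⟩
    3 * n            ≤⟨ q-lower ⟩
    16 * q + 3       ≡⟨ cong (_+ 3) (regroup₂ q) ⟩
    2 * (8 * q) + 3  ∎))

-- ... and for n ≥ 64p the second stage applies and its cycle is long enough.
q-large : ∀ {n q} p → 10 ≤ n → 64 * p ≤ n → 3 * n ≤ 16 * q + 3 →
  4 * p ≤ q + 1 × (∀ k → 2 * q + 5 ≤ k + 8 * p → n ≤ 4 * k)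
q-large {n} {q} p 10≤n 64p≤n q-lower = 4p≤q+1 , n≤4k
  where
  open ≤-Reasoning
  regroup₁ : ∀ n p → 2 * (n + 32 * p) ≡ 2 * n + 64 * p
  regroup₁ = solve-∀
  regroup₂ : ∀ n → 2 * n + n ≡ 3 * n
  regroup₂ = solve-∀
  regroup₃ : ∀ q → 16 * q + 40 ≡ 2 * (8 * q + 20)
  regroup₃ = solve-∀
  budget : n + 32 * p ≤ 8 * q + 20
  budget = *-cancelˡ-≤ 2 (begin
    2 * (n + 32 * p)  ≡⟨ regroup₁ n p ⟩
    2 * n + 64 * p    ≤⟨ +-monoʳ-≤ (2 * n) 64p≤n ⟩
    2 * n + n         ≡⟨ regroup₂ n ⟩
    3 * n             ≤⟨ q-lower ⟩
    16 * q + 3        ≤⟨ +-monoʳ-≤ (16 * q) (m≤m+n 3 37) ⟩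
    16 * q + 40       ≡⟨ regroup₃ q ⟩
    2 * (8 * q + 20)  ∎)
  regroup₄ : ∀ p → 8 * (4 * p) ≡ 32 * p
  regroup₄ = solve-∀
  regroup₅ : ∀ q → 8 * q + 20 ≡ 10 + (8 * q + 10)
  regroup₅ = solve-∀
  regroup₆ : ∀ q → 8 * q + 10 + 6 ≡ 8 * suc (q + 1)
  regroup₆ = solve-∀
  4p≤q+1 : 4 * p ≤ q + 1
  4p≤q+1 = m<1+n⇒m≤n (*-cancelˡ-< 8 (4 * p) (suc (q + 1)) (begin-strict
    8 * (4 * p)         ≡⟨ regroup₄ p ⟩
    32 * p              ≤⟨ +-cancelˡ-≤ 10 _ _ (≤-trans (+-monoˡ-≤ (32 * p) 10≤n)
                                                (≤-trans budget (≤-reflexive (regroup₅ q)))) ⟩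
    8 * q + 10          <⟨ m<m+n _ (s≤s z≤n) ⟩
    8 * q + 10 + 6      ≡⟨ regroup₆ q ⟩
    8 * suc (q + 1)     ∎))
  regroup₇ : ∀ q → 8 * q + 20 ≡ 4 * (2 * q + 5)
  regroup₇ = solve-∀
  regroup₈ : ∀ k p → 4 * (k + 8 * p) ≡ 4 * k + 32 * p
  regroup₈ = solve-∀
  n≤4k : ∀ k → 2 * q + 5 ≤ k + 8 * p → n ≤ 4 * k
  n≤4k k long = +-cancelʳ-≤ (32 * p) n (4 * k) (begin
    n + 32 * p       ≤⟨ budget ⟩
    8 * q + 20       ≡⟨ regroup₇ q ⟩
    4 * (2 * q + 5)  ≤⟨ *-monoʳ-≤ 4 long ⟩
    4 * (k + 8 * p)  ≡⟨ regroup₈ k p ⟩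
    4 * k + 32 * p   ∎)

longCycleFromPair : ∀ p′ {n} {G : Graph n} (c : TwoColouring G) {b q} →
  (10 * suc p′) ^ suc p′ ≤ n → ¬ KppInComplement (suc p′) G → 3 * n ≤ 16 * q + 3 →
  SeparatedPair c b q → Σ ℕ λ k → n ≤ 4 * k × MonoCycle c b k
longCycleFromPair zero {n} c {q = q} bound noKpp q-lower pair =
  2 * q , proj₂ q-fits , completePairCycle c noKpp pair (proj₁ q-fits)
  where
  q-fits : 2 ≤ q × n ≤ 4 * (2 * q)
  q-fits = q-large₁ {n} {q} (ten-bound zero n bound) q-lower
longCycleFromPair (suc p″) {n} c {b} {q} bound noKpp q-lower pair =
  withBound (Bipartite.bipartiteCycle c pair (suc p″) noKpp (proj₁ q-fits))
  where
  p : ℕ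
  p = suc (suc p″)
  q-fits : 4 * p ≤ q + 1 × (∀ k → 2 * q + 5 ≤ k + 8 * p → n ≤ 4 * k)
  q-fits = q-large {n} {q} p (ten-bound (suc p″) n bound) (linear-bound p″ n bound) q-lower
  -- The cycle is taken apart by pattern matching; projecting out of the search result
  -- instead would make the type checker try to evaluate the whole search.
  withBound : (Σ ℕ λ k → MonoCycle c b k × 2 * q + 5 ≤ k + 8 * p) → Σ ℕ λ k → n ≤ 4 * k × MonoCycle c b k
  withBound (k , cycle , long) = k , proj₂ q-fits k long , cycle

lemma21 : (p n : ℕ) → 1 ≤ p → 1 ≤ n → (10 * p) ^ p ≤ n →
    (G : Graph n) → ¬ KppInComplement p G →
    (c : TwoColouring G) →
    Σ Bool λ b → Σ ℕ λ k → (n ≤ 4 * k) × MonoCycle c b k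
lemma21 zero n () _ _ G noKpp c
lemma21 (suc p′) n _ _ bound G noKpp c = withQ (choose-q n)
  where
  Result : Set
  Result = Σ Bool λ b → Σ ℕ λ k → (n ≤ 4 * k) × MonoCycle c b k
  withQ : (Σ ℕ λ q → 16 * q ≤ 3 * n + 12 × 3 * n ≤ 16 * q + 3) → Result
  withQ (q , q-upper , q-lower) =
    afterFirstStage (longCycleOrSeparatedPair c true q q-upper (q-small {n} {q} (ten-bound p′ n bound) q-upper))
    where
    afterFirstStage : (Σ ℕ λ k → n ≤ 4 * k × MonoCycle c true k) ⊎ SeparatedPair c false q → Result
    afterFirstStage (inj₁ cycle) = true , cycle
    afterFirstStage (inj₂ pair) = false , longCycleFromPair p′ c bound noKpp q-lower pair
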